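{- Let $n\ge 1$ and $k\ge 0$ be integers. Let $\mathcal{F}_n^{(k)}$ be the set of integer sequences $(u_1,\ldots,u_n)$ satisfying $1\le u_i\le n+k+1$ for all $i$, $u_n>n$, and such that for all $1\le i<j\le n$, $u_j-(j-i)\notin[1,u_i-1]$. Then $|\mathcal{F}_n^{(k)}|=C_n^{(k)}$, where $C_n^{(k)}=\frac{k+1}{2n+k+1}\binom{2n+k+1}{n}$.
   Context: $[a,b]$ denotes the set of integers $m$ with $a\le m\le b$ (empty if $b<a$). -}

module Defs where

open import Data.Nat using (ℕ; zero; suc; _+_; _*_; _∸_; _≤_; _<_; _>_)
open import Data.Nat.Properties using (_≤?_; _<?_)
open import Data.Fin using (Fin; toℕ)
open import Data.Fin.Properties using (all?)
open import Relation.Nullary.Decidable using (_→-dec_)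
open import Data.Vec using (Vec; []; _∷_; lookup)
open import Data.List using (List; []; _∷_; map; concatMap; length; filter; upTo)
open import Data.Product using (_×_)
open import Relation.Nullary using (¬_; Dec)
open import Relation.Nullary.Decidable using (_×-dec_; ¬?)
open import Data.List.Relation.Unary.All using (All)
import Data.List.Relation.Unary.All as All

interval : ℕ → ℕ → List ℕ
interval a b = map (a +_) (upTo (suc b ∸ a))

seqs : (n m : ℕ) → List (Vec ℕ n)
seqs zero    m = [] ∷ []
seqs (suc n) m = concatMap (λ x → map (x ∷_) (seqs n m)) (interval 1 m)

-- u_j - (j - i) ∈ [1, u_i - 1] (computed over ℤ), written in ℕ:
--   1 ≤ u_j - (j-i)       ⇔  (j - i) + 1 ≤ u_j
--   u_j - (j-i) ≤ u_i - 1 ⇔  u_j + 1 ≤ u_i + (j - i)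
InBad : ℕ → ℕ → ℕ → Set
InBad d ui uj = (suc d ≤ uj) × (suc uj ≤ ui + d)

inBad? : ∀ d ui uj → Dec (InBad d ui uj)
inBad? d ui uj = (suc d ≤? uj) ×-dec (suc uj ≤? ui + d)

PairCond : ∀ {n} → Vec ℕ n → Set
PairCond {n} u = (i j : Fin n) → toℕ i < toℕ j →
  ¬ InBad (toℕ j ∸ toℕ i) (lookup u i) (lookup u j)

pairCond? : ∀ {n} (u : Vec ℕ n) → Dec (PairCond u)
pairCond? u = all? λ i → all? λ j →
  (toℕ i <? toℕ j) →-dec ¬? (inBad? (toℕ j ∸ toℕ i) (lookup u i) (lookup u j))

-- the last entry u_n (position n); only used when n ≥ 1 (value 0 for the empty sequence)
lastE : ∀ {n} → Vec ℕ n → ℕ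
lastE [] = 0
lastE (x ∷ []) = x
lastE (x ∷ y ∷ u) = lastE (y ∷ u)

-- membership in F_n^(k) for a sequence already known to satisfy 1 ≤ u_i ≤ n+k+1
-- (that range condition is built into the enumeration `seqs`): u_n > n and the pairwise condition
Cond : (n : ℕ) → Vec ℕ n → Set
Cond n u = (lastE u > n) × PairCond u

cond? : (n : ℕ) (u : Vec ℕ n) → Dec (Cond n u)
cond? n u = (suc n ≤? lastE u) ×-dec pairCond? u

card-F : (n k : ℕ) → ℕ
card-F n k = length (filter (cond? n) (seqs n (n + k + 1)))

-- Build the sequence from left to right. An earlier entry p at distance d forbids the interval
-- [d + 1, p + d − 1] for the next value, so after L entries the admissible next values consist of some
-- values in [1, L + 1] and all values from a threshold on. The number of valid completions depends
-- only on how many admissible values there are in each of these two parts, which gives a two-parameter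
-- recurrence. Its solution is a sum of ballot numbers; for the empty history it is the
-- ballot number b(n, k) = C(2n+k, n) − C(2n+k, n−1), which Pascal's rule and the absorption identity
-- (m + 1) C(N + 1, m + 1) = (N + 1) C(N, m) turn into (k+1)/(2n+k+1) · C(2n+k+1, n).

module Submission where

open import Defs
open import Data.Nat using (ℕ; zero; suc; _+_; _*_; _∸_; _≤_; _<_; z≤n; s≤s; _⊔_; _≤ᵇ_; s≤s⁻¹)
open import Data.Bool using (Bool; true; false; _∧_; not; if_then_else_; T)
open import Data.Bool.Properties using (T-∧; ∧-zeroʳ; ∧-identityʳ)
open import Data.List using (List; []; _∷_; length; _++_; map; concatMap; applyUpTo; filter)
open import Data.List.Properties using (map-upTo)
open import Data.Vec using (Vec; []; _∷_; lookup)
open import Data.Fin using (toℕ) renaming (zero to fzero; suc to fsuc)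
open import Data.Product using (_×_; _,_; proj₁; proj₂; uncurry)
open import Function.Bundles using (_⇔_; mk⇔; Equivalence)
open import Data.Nat.Properties
open import Data.Nat.Combinatorics using (_C_; nCk+nC[k+1]≡[n+1]C[k+1]; nCk≡nC[n∸k]; nC1≡n)
open import Data.Nat.Tactic.RingSolver using (solve-∀)
open import Relation.Binary.PropositionalEquality
open import Relation.Nullary using (Dec; does; yes; no; ¬_; ¬?; _×-dec_)
open import Relation.Nullary.Decidable using (dec-true; dec-false; does-⇔; T?)
open import Algebra.Properties.CommutativeSemigroup +-commutativeSemigroup using (interchange)

≤ᵇ-true : ∀ {m n} → m ≤ n → (m ≤ᵇ n) ≡ true
≤ᵇ-true {m} {n} = dec-true (m ≤? n)

≤ᵇ-false : ∀ {m n} → n < m → (m ≤ᵇ n) ≡ false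
≤ᵇ-false {m} {n} n<m = dec-false (m ≤? n) (<⇒≱ n<m)

≤ᵇ-suc : ∀ m n → (suc m ≤ᵇ suc n) ≡ (m ≤ᵇ n)
≤ᵇ-suc zero    n = refl
≤ᵇ-suc (suc m) n = refl

+-≤ᵇ : ∀ m n o → (m + n ≤ᵇ m + o) ≡ (n ≤ᵇ o)
+-≤ᵇ m n o = does-⇔ (mk⇔ (+-cancelˡ-≤ m n o) (+-monoʳ-≤ m)) (m + n ≤? m + o) (n ≤? o)

not-≤ᵇ : ∀ m n → not (suc m ≤ᵇ n) ≡ (n ≤ᵇ m)
not-≤ᵇ m n = does-⇔ (mk⇔ ≮⇒≥ ≤⇒≯) (¬? (suc m ≤? n)) (n ≤? m)

⊔-≤ᵇ : ∀ m n o → (m ⊔ n ≤ᵇ o) ≡ ((m ≤ᵇ o) ∧ (n ≤ᵇ o))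
⊔-≤ᵇ m n o = does-⇔ (mk⇔ (λ m⊔n≤o → m⊔n≤o⇒m≤o m n m⊔n≤o , m⊔n≤o⇒n≤o m n m⊔n≤o) (uncurry ⊔-lub))
                    (m ⊔ n ≤? o) ((m ≤? o) ×-dec (n ≤? o))

if-cong : ∀ {b b′ : Bool} {x y : ℕ} → b ≡ b′ → (T b′ → x ≡ y) → (if b then x else 0) ≡ (if b′ then y else 0)
if-cong {b′ = true}  refl x≡y = x≡y _
if-cong {b′ = false} refl x≡y = refl

∑ : ℕ → (ℕ → ℕ) → ℕ
∑ zero    f = 0
∑ (suc n) f = f 0 + ∑ n (λ i → f (suc i))

∑-cong< : ∀ n {f g : ℕ → ℕ} → (∀ i → i < n → f i ≡ g i) → ∑ n f ≡ ∑ n g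
∑-cong< zero    f≡g = refl
∑-cong< (suc n) f≡g = cong₂ _+_ (f≡g 0 (s≤s z≤n)) (∑-cong< n (λ i i<n → f≡g (suc i) (s≤s i<n)))

∑-cong : ∀ n {f g : ℕ → ℕ} → (∀ i → f i ≡ g i) → ∑ n f ≡ ∑ n g
∑-cong n f≡g = ∑-cong< n (λ i _ → f≡g i)

∑-zero : ∀ n {f : ℕ → ℕ} → (∀ i → i < n → f i ≡ 0) → ∑ n f ≡ 0
∑-zero zero    f≡0 = refl
∑-zero (suc n) f≡0 = cong₂ _+_ (f≡0 0 (s≤s z≤n)) (∑-zero n (λ i i<n → f≡0 (suc i) (s≤s i<n)))

∑-const-1 : ∀ n → ∑ n (λ _ → 1) ≡ n
∑-const-1 zero    = refl
∑-const-1 (suc n) = cong suc (∑-const-1 n)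

∑-+ : ∀ m n f → ∑ (m + n) f ≡ ∑ m f + ∑ n (λ j → f (m + j))
∑-+ zero    n f = refl
∑-+ (suc m) n f = trans (cong (f 0 +_) (∑-+ m n (λ i → f (suc i)))) (sym (+-assoc (f 0) _ _))

∑-snoc : ∀ n f → ∑ (suc n) f ≡ ∑ n f + f n
∑-snoc n f = begin
  ∑ (suc n) f           ≡⟨ cong (λ m → ∑ m f) (+-comm 1 n) ⟩
  ∑ (n + 1) f           ≡⟨ ∑-+ n 1 f ⟩
  ∑ n f + (f (n + 0) + 0) ≡⟨ cong (∑ n f +_) (trans (+-identityʳ _) (cong f (+-identityʳ n))) ⟩
  ∑ n f + f n           ∎
  where open ≡-Reasoning

∑-distrib-+ : ∀ n f g → ∑ n (λ i → f i + g i) ≡ ∑ n f + ∑ n g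
∑-distrib-+ zero    f g = refl
∑-distrib-+ (suc n) f g = begin
  (f 0 + g 0) + ∑ n (λ i → f (suc i) + g (suc i))
    ≡⟨ cong ((f 0 + g 0) +_) (∑-distrib-+ n (λ i → f (suc i)) (λ i → g (suc i))) ⟩
  (f 0 + g 0) + (∑ n (λ i → f (suc i)) + ∑ n (λ i → g (suc i)))
    ≡⟨ interchange (f 0) (g 0) _ _ ⟩
  (f 0 + ∑ n (λ i → f (suc i))) + (g 0 + ∑ n (λ i → g (suc i)))
    ∎
  where open ≡-Reasoning

∑-comm : ∀ m n (f : ℕ → ℕ → ℕ) → ∑ m (λ i → ∑ n (f i)) ≡ ∑ n (λ j → ∑ m (λ i → f i j))
∑-comm zero    n f = sym (∑-zero n (λ _ _ → refl))
∑-comm (suc m) n f = begin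
  ∑ n (f 0) + ∑ m (λ i → ∑ n (f (suc i)))            ≡⟨ cong (∑ n (f 0) +_) (∑-comm m n (λ i → f (suc i))) ⟩
  ∑ n (f 0) + ∑ n (λ j → ∑ m (λ i → f (suc i) j))    ≡⟨ ∑-distrib-+ n (f 0) _ ⟨
  ∑ n (λ j → f 0 j + ∑ m (λ i → f (suc i) j))        ∎
  where open ≡-Reasoning

∑-reverse : ∀ n f → ∑ n (λ j → f (n ∸ suc j)) ≡ ∑ n f
∑-reverse zero    f = refl
∑-reverse (suc n) f = begin
  f n + ∑ n (λ j → f (n ∸ suc j))   ≡⟨ cong (f n +_) (∑-reverse n f) ⟩
  f n + ∑ n f                       ≡⟨ +-comm (f n) _ ⟩
  ∑ n f + f n                       ≡⟨ ∑-snoc n f ⟨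
  ∑ (suc n) f                       ∎
  where open ≡-Reasoning

∑-dropZeros : ∀ n e {f : ℕ → ℕ} → (∀ i → i < e → f i ≡ 0) → ∑ n f ≡ ∑ (n ∸ e) (λ j → f (e + j))
∑-dropZeros n e {f} f≡0 with n ≤? e
... | yes n≤e = begin
  ∑ n f                       ≡⟨ ∑-zero n (λ i i<n → f≡0 i (<-≤-trans i<n n≤e)) ⟩
  0                           ≡⟨ cong (λ m → ∑ m (λ j → f (e + j))) (m≤n⇒m∸n≡0 n≤e) ⟨
  ∑ (n ∸ e) (λ j → f (e + j)) ∎
  where open ≡-Reasoning
... | no n≰e = begin
  ∑ n f                                   ≡⟨ cong (λ m → ∑ m f) (m+[n∸m]≡n e≤n) ⟨
  ∑ (e + (n ∸ e)) f                       ≡⟨ ∑-+ e (n ∸ e) f ⟩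
  ∑ e f + ∑ (n ∸ e) (λ j → f (e + j))     ≡⟨ cong (_+ ∑ (n ∸ e) (λ j → f (e + j))) (∑-zero e f≡0) ⟩
  ∑ (n ∸ e) (λ j → f (e + j))             ∎
  where
  open ≡-Reasoning
  e≤n : e ≤ n
  e≤n = <⇒≤ (≰⇒> n≰e)

count< : ℕ → (ℕ → Bool) → ℕ
count< n P = ∑ n (λ i → if P i then 1 else 0)

-- Reindexing a sum over the i < n with P i by the rank of i counted from the top.
∑-by-rank : ∀ n (P : ℕ → Bool) (g : ℕ → ℕ) →
            ∑ n (λ i → if P i then g (count< n (λ j → (i ≤ᵇ j) ∧ P j)) else 0) ≡ ∑ (count< n P) (λ q → g (suc q))
∑-by-rank zero    P g = refl
∑-by-rank (suc n) P g = trans (cong (first (P 0) +_) rest≡) (merge (P 0))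
  where
  c : ℕ
  c = count< n (λ i → P (suc i))
  first : Bool → ℕ
  first b = if b then g ((if b then 1 else 0) + c) else 0
  rest≡ : ∑ n (λ i → if P (suc i) then g (count< n (λ j → (suc i ≤ᵇ suc j) ∧ P (suc j))) else 0)
          ≡ ∑ c (λ q → g (suc q))
  rest≡ = trans (∑-cong n (λ i → cong (λ m → if P (suc i) then g m else 0)
                                   (∑-cong n (λ j → cong (λ b → if b ∧ P (suc j) then 1 else 0) (≤ᵇ-suc i j)))))
                (∑-by-rank n (λ i → P (suc i)) g)
  merge : ∀ b → first b + ∑ c (λ q → g (suc q)) ≡ ∑ ((if b then 1 else 0) + c) (λ q → g (suc q))
  merge true  = trans (+-comm (g (suc c)) _) (sym (∑-snoc c (λ q → g (suc q))))
  merge false = refl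

∑-suffix-reversed : ∀ n e (f : ℕ → ℕ) → ∑ n (λ j → if e ≤ᵇ j then f (n ∸ suc j) else 0) ≡ ∑ (n ∸ e) f
∑-suffix-reversed n e f = begin
  ∑ n (λ j → if e ≤ᵇ j then f (n ∸ suc j) else 0)
    ≡⟨ ∑-dropZeros n e (λ j j<e → cong (λ b → if b then f (n ∸ suc j) else 0) (≤ᵇ-false j<e)) ⟩
  ∑ (n ∸ e) (λ j → if e ≤ᵇ e + j then f (n ∸ suc (e + j)) else 0)
    ≡⟨ ∑-cong (n ∸ e) (λ j → cong₂ (λ b m → if b then f m else 0) (≤ᵇ-true (m≤m+n e j))
                                   (trans (cong (n ∸_) (sym (+-suc e j))) (sym (∸-+-assoc n e (suc j))))) ⟩
  ∑ (n ∸ e) (λ j → f (n ∸ e ∸ suc j))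
    ≡⟨ ∑-reverse (n ∸ e) f ⟩
  ∑ (n ∸ e) f
    ∎
  where open ≡-Reasoning

count : ∀ {A : Set} → (A → Bool) → List A → ℕ
count f []       = 0
count f (x ∷ xs) = if f x then suc (count f xs) else count f xs

length-filter≡count : ∀ {A : Set} {P : A → Set} (P? : ∀ a → Dec (P a)) xs →
                      length (filter P? xs) ≡ count (λ a → does (P? a)) xs
length-filter≡count P? []       = refl
length-filter≡count P? (x ∷ xs) with does (P? x)
... | true  = cong suc (length-filter≡count P? xs)
... | false = length-filter≡count P? xs

count-cong : ∀ {A : Set} {f g : A → Bool} xs → (∀ a → f a ≡ g a) → count f xs ≡ count g xs
count-cong []       f≡g = refl
count-cong (x ∷ xs) f≡g = cong₂ (λ b n → if b then suc n else n) (f≡g x) (count-cong xs f≡g)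

count-++ : ∀ {A : Set} (f : A → Bool) xs ys → count f (xs ++ ys) ≡ count f xs + count f ys
count-++ f []       ys = refl
count-++ f (x ∷ xs) ys with f x
... | true  = cong suc (count-++ f xs ys)
... | false = count-++ f xs ys

count-map : ∀ {A B : Set} (f : B → Bool) (h : A → B) xs → count f (map h xs) ≡ count (λ a → f (h a)) xs
count-map f h []       = refl
count-map f h (x ∷ xs) = cong (λ n → if f (h x) then suc n else n) (count-map f h xs)

count-false : ∀ {A : Set} (xs : List A) → count (λ _ → false) xs ≡ 0
count-false []       = refl
count-false (x ∷ xs) = count-false xs

count-∧ : ∀ {A : Set} b (f : A → Bool) xs → count (λ a → b ∧ f a) xs ≡ (if b then count f xs else 0)
count-∧ true  f xs = refl
count-∧ false f xs = count-false xs

count-concatMap : ∀ {A : Set} (f : A → Bool) (F : ℕ → List A) n s →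
                  count f (concatMap F (applyUpTo s n)) ≡ ∑ n (λ i → count f (F (s i)))
count-concatMap f F zero    s = refl
count-concatMap f F (suc n) s = trans (count-++ f (F (s 0)) _) (cong (count f (F (s 0)) +_) (count-concatMap f F n (λ i → s (suc i))))

count-seqs : ∀ m B (f : Vec ℕ (suc m) → Bool) →
             count f (seqs (suc m) B) ≡ ∑ B (λ i → count (λ u → f (suc i ∷ u)) (seqs m B))
count-seqs m B f = begin
  count f (concatMap F (map suc (applyUpTo (λ i → i) B)))  ≡⟨ cong (λ xs → count f (concatMap F xs)) (map-upTo suc B) ⟩
  count f (concatMap F (applyUpTo suc B))                  ≡⟨ count-concatMap f F B suc ⟩
  ∑ B (λ i → count f (F (suc i)))                          ≡⟨ ∑-cong B (λ i → count-map f (suc i ∷_) (seqs m B)) ⟩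
  ∑ B (λ i → count (λ u → f (suc i ∷ u)) (seqs m B))       ∎
  where
  open ≡-Reasoning
  F : ℕ → List (Vec ℕ (suc m))
  F x = map (x ∷_) (seqs m B)

[k+1]*[n+1]C[k+1]≡[n+1]*nCk : ∀ n k → suc k * (suc n C suc k) ≡ suc n * (n C k)
[k+1]*[n+1]C[k+1]≡[n+1]*nCk zero    zero    = refl
[k+1]*[n+1]C[k+1]≡[n+1]*nCk zero    (suc k) = *-zeroʳ (suc (suc k))
[k+1]*[n+1]C[k+1]≡[n+1]*nCk (suc n) zero    = trans (*-identityˡ _) (trans (nC1≡n (suc (suc n))) (sym (*-identityʳ _)))
[k+1]*[n+1]C[k+1]≡[n+1]*nCk (suc n) (suc k) = begin
  suc (suc k) * (suc (suc n) C suc (suc k))     ≡⟨ cong (suc (suc k) *_) (nCk+nC[k+1]≡[n+1]C[k+1] (suc n) (suc k)) ⟨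
  suc (suc k) * (x + y)                         ≡⟨ *-distribˡ-+ (suc (suc k)) x y ⟩
  suc (suc k) * x + suc (suc k) * y             ≡⟨ cong (suc (suc k) * x +_) ([k+1]*[n+1]C[k+1]≡[n+1]*nCk n (suc k)) ⟩
  (x + suc k * x) + suc n * (n C suc k)         ≡⟨ cong (λ z → (x + z) + suc n * (n C suc k)) ([k+1]*[n+1]C[k+1]≡[n+1]*nCk n k) ⟩
  (x + suc n * (n C k)) + suc n * (n C suc k)   ≡⟨ +-assoc x _ _ ⟩
  x + (suc n * (n C k) + suc n * (n C suc k))   ≡⟨ cong (x +_) (*-distribˡ-+ (suc n) (n C k) (n C suc k)) ⟨
  x + suc n * (n C k + n C suc k)               ≡⟨ cong (λ z → x + suc n * z) (nCk+nC[k+1]≡[n+1]C[k+1] n k) ⟩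
  x + suc n * x                                 ∎
  where
  open ≡-Reasoning
  x : ℕ
  x = suc n C suc k
  y : ℕ
  y = suc n C suc (suc k)

[a+c]Ca≡[a+c]Cc : ∀ a c → (a + c) C a ≡ (a + c) C c
[a+c]Ca≡[a+c]Cc a c = trans (nCk≡nC[n∸k] (m≤m+n a c)) (cong ((a + c) C_) (m+n∸m≡n a c))

ballot : ℕ → ℕ → ℕ
ballot zero    s = 1
ballot (suc m) s = ∑ (suc s) (λ j → ballot m (suc j))

ballot-suc : ∀ m s → ballot (suc m) (suc s) ≡ ballot (suc m) s + ballot m (suc (suc s))
ballot-suc m s = ∑-snoc (suc s) (λ j → ballot m (suc j))

ballot-binomial : ∀ m s → ballot (suc m) s + (2 + m + m + s) C m ≡ (2 + m + m + s) C suc m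
ballot-binomial zero    zero    = refl
ballot-binomial zero    (suc s) = begin
  ballot 1 (suc s) + 1          ≡⟨ cong (_+ 1) (ballot-suc 0 s) ⟩
  (ballot 1 s + 1) + 1          ≡⟨ cong (_+ 1) (ballot-binomial 0 s) ⟩
  (2 + s) C 1 + 1               ≡⟨ cong (_+ 1) (nC1≡n (2 + s)) ⟩
  2 + s + 1                     ≡⟨ +-comm (2 + s) 1 ⟩
  3 + s                         ≡⟨ nC1≡n (3 + s) ⟨
  (3 + s) C 1                   ∎
  where open ≡-Reasoning
ballot-binomial (suc m) zero    = begin
  ballot (suc m) 1 + 0 + W C suc m
    ≡⟨ cong₂ _+_ (+-identityʳ (ballot (suc m) 1)) (sym (nCk+nC[k+1]≡[n+1]C[k+1] U m)) ⟩
  ballot (suc m) 1 + (U C m + U C suc m)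
    ≡⟨ +-assoc (ballot (suc m) 1) _ _ ⟨
  (ballot (suc m) 1 + U C m) + U C suc m
    ≡⟨ cong₂ _+_ ih symmetry ⟩
  U C suc m + U C suc (suc m)
    ≡⟨ nCk+nC[k+1]≡[n+1]C[k+1] U (suc m) ⟩
  W C suc (suc m)
    ∎
  where
  open ≡-Reasoning
  W : ℕ
  W = 2 + suc m + suc m + 0
  U : ℕ
  U = 2 + m + suc m + 0
  ih : ballot (suc m) 1 + U C m ≡ U C suc m
  ih = subst (λ u → ballot (suc m) 1 + u C m ≡ u C suc m) (lemma m) (ballot-binomial m 1)
    where
    lemma : ∀ m → 2 + m + m + 1 ≡ 2 + m + suc m + 0
    lemma = solve-∀
  symmetry : U C suc m ≡ U C suc (suc m)
  symmetry = subst (λ u → u C suc m ≡ u C suc (suc m)) (lemma m) (sym ([a+c]Ca≡[a+c]Cc (suc (suc m)) (suc m)))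
    where
    lemma : ∀ m → suc (suc m) + suc m ≡ 2 + m + suc m + 0
    lemma = solve-∀
ballot-binomial (suc m) (suc s) = begin
  ballot (suc (suc m)) (suc s) + W′ C suc m
    ≡⟨ cong₂ (λ b u → b + u C suc m) (ballot-suc (suc m) s) W′≡ ⟩
  (ballot (suc (suc m)) s + ballot (suc m) (2 + s)) + suc W C suc m
    ≡⟨ cong₂ _+_ (+-comm (ballot (suc (suc m)) s) _) (sym (nCk+nC[k+1]≡[n+1]C[k+1] W m)) ⟩
  (ballot (suc m) (2 + s) + ballot (suc (suc m)) s) + (W C m + W C suc m)
    ≡⟨ interchange (ballot (suc m) (2 + s)) _ _ _ ⟩
  (ballot (suc m) (2 + s) + W C m) + (ballot (suc (suc m)) s + W C suc m)
    ≡⟨ cong₂ _+_ (subst (λ u → ballot (suc m) (2 + s) + u C m ≡ u C suc m) W≡ (ballot-binomial m (2 + s)))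
                 (ballot-binomial (suc m) s) ⟩
  W C suc m + W C suc (suc m)
    ≡⟨ nCk+nC[k+1]≡[n+1]C[k+1] W (suc m) ⟩
  suc W C suc (suc m)
    ≡⟨ cong (_C suc (suc m)) W′≡ ⟨
  W′ C suc (suc m)
    ∎
  where
  open ≡-Reasoning
  W : ℕ
  W = 2 + suc m + suc m + s
  W′ : ℕ
  W′ = 2 + suc m + suc m + suc s
  W′≡ : W′ ≡ suc W
  W′≡ = +-suc (2 + suc m + suc m) s
  W≡ : 2 + m + m + (2 + s) ≡ W
  W≡ = lemma m s
    where
    lemma : ∀ m s → 2 + m + m + (2 + s) ≡ 2 + suc m + suc m + s
    lemma = solve-∀

difference-identity : ∀ a c b X Y → b + X ≡ Y → a * (X + Y) ≡ (a + a + c) * X →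
                      (a + a + c) * b ≡ c * (X + Y)
difference-identity a c b X Y b+X≡Y a[X+Y]≡NX = +-cancelʳ-≡ (N * X) (N * b) (c * Z) (begin
  N * b + N * X        ≡⟨ *-distribˡ-+ N b X ⟨
  N * (b + X)          ≡⟨ cong (N *_) b+X≡Y ⟩
  N * Y                ≡⟨ +-cancelʳ-≡ (a * Z) (N * Y) (c * Z + a * Z) NY+aZ≡ ⟩
  c * Z + a * Z        ≡⟨ cong (c * Z +_) a[X+Y]≡NX ⟩
  c * Z + N * X        ∎)
  where
  open ≡-Reasoning
  N : ℕ
  N = a + a + c
  Z : ℕ
  Z = X + Y
  expand : ∀ a c Z → (a + a + c) * Z ≡ (c * Z + a * Z) + a * Z
  expand = solve-∀
  NY+aZ≡ : N * Y + a * Z ≡ (c * Z + a * Z) + a * Z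
  NY+aZ≡ = begin
    N * Y + a * Z      ≡⟨ cong (N * Y +_) a[X+Y]≡NX ⟩
    N * Y + N * X      ≡⟨ +-comm (N * Y) (N * X) ⟩
    N * X + N * Y      ≡⟨ *-distribˡ-+ N X Y ⟨
    N * Z              ≡⟨ expand a c Z ⟩
    (c * Z + a * Z) + a * Z ∎

ballot-closedForm : ∀ m k → (suc m + suc m + k + 1) * ballot (suc m) k ≡ (k + 1) * ((suc m + suc m + k + 1) C suc m)
ballot-closedForm m k = begin
  (suc m + suc m + k + 1) * ballot (suc m) k   ≡⟨ cong (_* ballot (suc m) k) (+-assoc (suc m + suc m) k 1) ⟩
  N * ballot (suc m) k                         ≡⟨ difference-identity (suc m) (k + 1) (ballot (suc m) k) X Y (ballot-binomial m k) absorption ⟩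
  (k + 1) * (X + Y)                            ≡⟨ cong ((k + 1) *_) (nCk+nC[k+1]≡[n+1]C[k+1] W m) ⟩
  (k + 1) * (suc W C suc m)                    ≡⟨ cong (λ n → (k + 1) * (n C suc m)) suc[W]≡ ⟩
  (k + 1) * ((suc m + suc m + k + 1) C suc m)  ∎
  where
  open ≡-Reasoning
  N : ℕ
  N = suc m + suc m + (k + 1)
  W : ℕ
  W = 2 + m + m + k
  X : ℕ
  X = W C m
  Y : ℕ
  Y = W C suc m
  suc[W]≡ : suc W ≡ suc m + suc m + k + 1
  suc[W]≡ = lemma m k
    where
    lemma : ∀ m k → suc (2 + m + m + k) ≡ suc m + suc m + k + 1
    lemma = solve-∀
  absorption : suc m * (X + Y) ≡ N * X
  absorption = begin
    suc m * (X + Y)         ≡⟨ cong (suc m *_) (nCk+nC[k+1]≡[n+1]C[k+1] W m) ⟩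
    suc m * (suc W C suc m) ≡⟨ [k+1]*[n+1]C[k+1]≡[n+1]*nCk W m ⟩
    suc W * X               ≡⟨ cong (_* X) (trans suc[W]≡ (+-assoc (suc m + suc m) k 1)) ⟩
    N * X                   ∎

-- The number of ways to append R + 1 entries, the last one high, to a history offering p admissible
-- low values and v admissible high values: appending the low value of rank q from the top leaves
-- q + 2 low and v − 1 high values, appending a high value leaves the value 1 and the high values above it.
completions : ℕ → ℕ → ℕ → ℕ
completions zero    p v = v
completions (suc R) p v = ∑ p (λ q → completions R (2 + q) (v ∸ 1)) + ∑ v (completions R 1)

∑-∑-prefixes : ∀ R v g → ∑ v (λ w → ∑ (w ∸ R) g) ≡ ∑ (v ∸ suc R) (λ t → ∑ (suc t) g)
∑-∑-prefixes R v g = trans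
  (∑-dropZeros v (suc R) (λ w w≤R → cong (λ n → ∑ n g) (m≤n⇒m∸n≡0 (≤-pred w≤R))))
  (∑-cong (v ∸ suc R) (λ t → cong (λ n → ∑ n g) (trans (cong (_∸ R) (sym (+-suc R t))) (m+n∸m≡n R (suc t)))))

completions-closedForm : ∀ R p v → completions R p v ≡ ∑ (v ∸ R) (λ t → ballot R (p + t))
completions-closedForm zero    p v = sym (∑-const-1 v)
completions-closedForm (suc R) p v = begin
  ∑ p (λ q → completions R (2 + q) (v ∸ 1)) + ∑ v (completions R 1)
    ≡⟨ cong₂ _+_ (∑-cong p (λ q → trans (completions-closedForm R (2 + q) (v ∸ 1))
                                        (cong (λ n → ∑ n (λ t → ballot R (2 + q + t))) (∸-+-assoc v 1 R))))
                 (∑-cong v (λ w → completions-closedForm R 1 w)) ⟩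
  ∑ p (λ q → ∑ m (λ t → g (suc (q + t)))) + ∑ v (λ w → ∑ (w ∸ R) g)
    ≡⟨ cong₂ _+_ (∑-comm p m (λ q t → g (suc (q + t)))) (∑-∑-prefixes R v g) ⟩
  ∑ m (λ t → ∑ p (λ q → g (suc (q + t)))) + ∑ m (λ t → ∑ (suc t) g)
    ≡⟨ +-comm (∑ m (λ t → ∑ p (λ q → g (suc (q + t))))) _ ⟩
  ∑ m (λ t → ∑ (suc t) g) + ∑ m (λ t → ∑ p (λ q → g (suc (q + t))))
    ≡⟨ ∑-distrib-+ m _ _ ⟨
  ∑ m (λ t → ∑ (suc t) g + ∑ p (λ q → g (suc (q + t))))
    ≡⟨ ∑-cong m (λ t → cong (∑ (suc t) g +_) (∑-cong p (λ q → cong (λ n → g (suc n)) (+-comm q t)))) ⟩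
  ∑ m (λ t → ∑ (suc t) g + ∑ p (λ q → g (suc t + q)))
    ≡⟨ ∑-cong m (λ t → trans (sym (∑-+ (suc t) p g)) (cong (λ n → ∑ (suc n) g) (+-comm t p))) ⟩
  ∑ m (λ t → ballot (suc R) (p + t))
    ∎
  where
  open ≡-Reasoning
  m : ℕ
  m = v ∸ suc R
  g : ℕ → ℕ
  g t = ballot R (suc t)

-- A history lists the entries chosen so far, most recent first; admits d ps y says that y may follow ps
-- when the head of ps lies at distance d before it.
admits : ℕ → List ℕ → ℕ → Bool
admits d []       y = true
admits d (p ∷ ps) y = not (does (inBad? d p y)) ∧ admits (suc d) ps y

-- An entry p at distance d forbids the values d + 1, …, p + d − 1, so a value above length ps + 1
-- may follow ps exactly when it is ≥ threshold ps (admits-high).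
threshold : List ℕ → ℕ
threshold []       = 2
threshold (p ∷ ps) = suc (p ⊔ threshold ps)

threshold-≥ : ∀ ps → 2 + length ps ≤ threshold ps
threshold-≥ []       = ≤-refl
threshold-≥ (x ∷ ps) = s≤s (≤-trans (threshold-≥ ps) (m≤n⊔m x (threshold ps)))

admits-shift : ∀ d ps y → admits (suc d) ps (suc y) ≡ admits d ps y
admits-shift d []       y = refl
admits-shift d (p ∷ ps) y = cong₂ (λ b c → not b ∧ c) inBad-shift (admits-shift (suc d) ps y)
  where
  inBad-shift : does (inBad? (suc d) p (suc y)) ≡ does (inBad? d p y)
  inBad-shift = does-⇔ (mk⇔ (λ (d<y , y<p+d) → s≤s⁻¹ d<y , s≤s⁻¹ (subst (suc (suc y) ≤_) (+-suc p d) y<p+d))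
                             (λ (d<y , y<p+d) → s≤s d<y , subst (suc (suc y) ≤_) (sym (+-suc p d)) (s≤s y<p+d)))
                       (inBad? (suc d) p (suc y)) (inBad? d p y)

admits-zero : ∀ d ps → admits (suc d) ps 0 ≡ true
admits-zero d []       = refl
admits-zero d (p ∷ ps) = admits-zero (suc d) ps

admits-one : ∀ ps → admits 1 ps 1 ≡ true
admits-one []       = refl
admits-one (p ∷ ps) = trans (admits-shift 1 ps 0) (admits-zero 0 ps)

admits-∷ : ∀ x ps j → admits 1 (x ∷ ps) (2 + j) ≡ (x ≤ᵇ suc j) ∧ admits 1 ps (suc j)
admits-∷ x ps j = cong₂ _∧_ x<2+j (admits-shift 1 ps (suc j))
  where
  x<2+j : not (suc (suc (suc j)) ≤ᵇ x + 1) ≡ (x ≤ᵇ suc j)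
  x<2+j = trans (cong (λ n → not (suc (suc (suc j)) ≤ᵇ n)) (+-comm x 1))
                (trans (not-≤ᵇ (suc (suc j)) (suc x)) (≤ᵇ-suc x (suc j)))

admits-high : ∀ ps y → 2 + length ps ≤ y → admits 1 ps y ≡ (threshold ps ≤ᵇ y)
admits-high []       y 2≤y = sym (≤ᵇ-true 2≤y)
admits-high (x ∷ ps) (suc (suc j)) (s≤s (s≤s L≤j)) = begin
  admits 1 (x ∷ ps) (2 + j)                         ≡⟨ admits-∷ x ps j ⟩
  (x ≤ᵇ suc j) ∧ admits 1 ps (suc j)                ≡⟨ cong ((x ≤ᵇ suc j) ∧_) (admits-high ps (suc j) (s≤s L≤j)) ⟩
  (x ≤ᵇ suc j) ∧ (threshold ps ≤ᵇ suc j)            ≡⟨ ⊔-≤ᵇ x (threshold ps) (suc j) ⟨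
  (x ⊔ threshold ps ≤ᵇ suc j)                       ≡⟨ ≤ᵇ-suc (x ⊔ threshold ps) (suc j) ⟨
  (threshold (x ∷ ps) ≤ᵇ 2 + j)                     ∎
  where open ≡-Reasoning

lowCount : List ℕ → ℕ
lowCount ps = count< (suc (length ps)) (λ i → admits 1 ps (suc i))

lowCount-low : ∀ i ps → lowCount (suc i ∷ ps) ≡ suc (count< (suc (length ps)) (λ j → (i ≤ᵇ j) ∧ admits 1 ps (suc j)))
lowCount-low i ps = cong₂ _+_
  (cong (λ b → if b then 1 else 0) (admits-one (suc i ∷ ps)))
  (∑-cong (suc (length ps)) (λ j → cong (λ b → if b then 1 else 0)
     (trans (admits-∷ (suc i) ps j) (cong (_∧ admits 1 ps (suc j)) (≤ᵇ-suc i j)))))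

lowCount-high : ∀ y ps → 2 + length ps ≤ y → lowCount (y ∷ ps) ≡ 1
lowCount-high y ps 2+L≤y = cong₂ _+_
  (cong (λ b → if b then 1 else 0) (admits-one (y ∷ ps)))
  (∑-zero (suc (length ps)) (λ j j<1+L → cong (λ b → if b then 1 else 0)
     (trans (admits-∷ y ps j) (cong (_∧ admits 1 ps (suc j)) (≤ᵇ-false (≤-trans (s≤s j<1+L) 2+L≤y))))))

admits-above : ∀ ps j → admits 1 ps (2 + length ps + j) ≡ (threshold ps ∸ (2 + length ps) ≤ᵇ j)
admits-above ps j = begin
  admits 1 ps (2 + L + j)              ≡⟨ admits-high ps (2 + L + j) (m≤m+n (2 + L) j) ⟩
  (threshold ps ≤ᵇ 2 + L + j)          ≡⟨ cong (_≤ᵇ 2 + L + j) (m+[n∸m]≡n (threshold-≥ ps)) ⟨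
  (2 + L + (threshold ps ∸ (2 + L)) ≤ᵇ 2 + L + j) ≡⟨ +-≤ᵇ (2 + L) _ j ⟩
  (threshold ps ∸ (2 + L) ≤ᵇ j)        ∎
  where
  open ≡-Reasoning
  L : ℕ
  L = length ps

T-not-does : ∀ {A : Set} (a? : Dec A) → T (not (does a?)) ⇔ (¬ A)
T-not-does (yes a) = mk⇔ (λ ()) (λ ¬a → ¬a a)
T-not-does (no ¬a) = mk⇔ (λ _ → ¬a) (λ _ → _)

T-admits-∷ : ∀ d p ps y → T (admits d (p ∷ ps) y) ⇔ (¬ InBad d p y × T (admits (suc d) ps y))
T-admits-∷ d p ps y = mk⇔
  (λ h → let (¬bad , rest) = Equivalence.to T-∧ h in Equivalence.to (T-not-does (inBad? d p y)) ¬bad , rest)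
  (λ (¬bad , rest) → Equivalence.from T-∧ (Equivalence.from (T-not-does (inBad? d p y)) ¬bad , rest))

PairCond-∷ : ∀ {m} x (u : Vec ℕ m) → PairCond (x ∷ u) ⇔ (PairCond u × (∀ j → ¬ InBad (suc (toℕ j)) x (lookup u j)))
PairCond-∷ x u = mk⇔ (λ h → (λ i j i<j → h (fsuc i) (fsuc j) (s≤s i<j)) , (λ j → h fzero (fsuc j) (s≤s z≤n))) from
  where
  from : PairCond u × (∀ j → ¬ InBad (suc (toℕ j)) x (lookup u j)) → PairCond (x ∷ u)
  from (pc , head) fzero     (fsuc j) _         = head j
  from (pc , head) (fsuc i)  (fsuc j) (s≤s i<j) = pc i j i<j

accepts : ℕ → List ℕ → ∀ {m} → Vec ℕ (suc m) → Bool
accepts N ps (x ∷ [])    = admits 1 ps x ∧ (suc N ≤ᵇ x)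
accepts N ps (x ∷ y ∷ u) = admits 1 ps x ∧ accepts N (x ∷ ps) (y ∷ u)

AdmittedBy : List ℕ → ∀ {m} → Vec ℕ m → Set
AdmittedBy ps u = ∀ j → T (admits (suc (toℕ j)) ps (lookup u j))

accepts⇒ : ∀ N ps {m} (u : Vec ℕ (suc m)) → T (accepts N ps u) → N < lastE u × PairCond u × AdmittedBy ps u
accepts⇒ N ps (x ∷ []) h with Equivalence.to T-∧ h
... | admitted , N<x =
  ≤ᵇ⇒≤ (suc N) x N<x , Equivalence.from (PairCond-∷ x []) ((λ ()) , (λ ())) , λ { fzero → admitted }
accepts⇒ N ps (x ∷ y ∷ u) h with Equivalence.to T-∧ h
... | admitted , rest with accepts⇒ N (x ∷ ps) (y ∷ u) rest
... | N<last , pc , admittedRest =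
  N<last , Equivalence.from (PairCond-∷ x (y ∷ u)) (pc , λ j → proj₁ (split j)) ,
  λ { fzero → admitted ; (fsuc j) → proj₂ (split j) }
  where
  split : ∀ j → ¬ InBad (suc (toℕ j)) x (lookup (y ∷ u) j) × T (admits (suc (suc (toℕ j))) ps (lookup (y ∷ u) j))
  split j = Equivalence.to (T-admits-∷ (suc (toℕ j)) x ps _) (admittedRest j)

⇒accepts : ∀ N ps {m} (u : Vec ℕ (suc m)) → N < lastE u × PairCond u × AdmittedBy ps u → T (accepts N ps u)
⇒accepts N ps (x ∷ []) (N<x , _ , admitted) = Equivalence.from T-∧ (admitted fzero , ≤⇒≤ᵇ N<x)
⇒accepts N ps (x ∷ y ∷ u) (N<last , pc , admitted) with Equivalence.to (PairCond-∷ x (y ∷ u)) pc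
... | pcRest , head = Equivalence.from T-∧ (admitted fzero , ⇒accepts N (x ∷ ps) (y ∷ u) (N<last , pcRest , admittedRest))
  where
  admittedRest : AdmittedBy (x ∷ ps) (y ∷ u)
  admittedRest j = Equivalence.from (T-admits-∷ (suc (toℕ j)) x ps _) (head j , admitted (fsuc j))

cond≡accepts : ∀ {m} (u : Vec ℕ (suc m)) → does (cond? (suc m) u) ≡ accepts (suc m) [] u
cond≡accepts {m} u = does-⇔
  (mk⇔ (λ (N<last , pc) → ⇒accepts (suc m) [] u (N<last , pc , λ _ → _))
       (λ h → let (N<last , pc , _) = accepts⇒ (suc m) [] u h in N<last , pc))
  (cond? (suc m) u) (T? (accepts (suc m) [] u))

accepts-∷ : ∀ N ps x {m} (u : Vec ℕ (suc m)) → accepts N ps (x ∷ u) ≡ admits 1 ps x ∧ accepts N (x ∷ ps) u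
accepts-∷ N ps x (y ∷ u) = refl

module Counting (N k : ℕ) where

  B : ℕ
  B = N + suc k

  continuations : ℕ → List ℕ → ℕ
  continuations R ps = count (accepts N ps) (seqs (suc R) B)

  continuations-zero : ∀ ps → continuations 0 ps ≡ ∑ B (λ i → if admits 1 ps (suc i) ∧ (suc N ≤ᵇ suc i) then 1 else 0)
  continuations-zero ps = count-seqs 0 B (accepts N ps)

  continuations-suc : ∀ R ps →
    continuations (suc R) ps ≡ ∑ B (λ i → if admits 1 ps (suc i) then continuations R (suc i ∷ ps) else 0)
  continuations-suc R ps = trans (count-seqs (suc R) B (accepts N ps))
    (∑-cong B (λ i → trans (count-cong (seqs (suc R) B) (accepts-∷ N ps (suc i)))
                           (count-∧ (admits 1 ps (suc i)) (accepts N (suc i ∷ ps)) (seqs (suc R) B))))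

  Counts : ℕ → Set
  Counts R = ∀ ps → length ps + suc R ≡ N → continuations R ps ≡ completions R (lowCount ps) (suc B ∸ threshold ps)

  B-split : ∀ L R → L + suc R ≡ N → B ≡ suc L + (R + suc k)
  B-split L R L+1+R≡N = begin
    N + suc k              ≡⟨ cong (_+ suc k) L+1+R≡N ⟨
    L + suc R + suc k      ≡⟨ cong (_+ suc k) (+-suc L R) ⟩
    suc (L + R + suc k)    ≡⟨ cong suc (+-assoc L R (suc k)) ⟩
    suc L + (R + suc k)    ∎
    where open ≡-Reasoning

  suc[B]∸threshold : ∀ ps M → B ≡ suc (length ps) + M → suc B ∸ threshold ps ≡ M ∸ (threshold ps ∸ (2 + length ps))
  suc[B]∸threshold ps M B≡ = begin
    suc B ∸ threshold ps                                 ≡⟨ cong₂ (λ b t → suc b ∸ t) B≡ (sym (m+[n∸m]≡n (threshold-≥ ps))) ⟩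
    (2 + L + M) ∸ (2 + L + (threshold ps ∸ (2 + L)))     ≡⟨ [m+n]∸[m+o]≡n∸o (2 + L) M _ ⟩
    M ∸ (threshold ps ∸ (2 + L))                         ∎
    where
    open ≡-Reasoning
    L : ℕ
    L = length ps

  counts-zero : Counts 0
  counts-zero ps L+1≡N = begin
    continuations 0 ps                                   ≡⟨ continuations-zero ps ⟩
    ∑ B F                                                ≡⟨ cong (λ n → ∑ n F) (B-split L 0 L+1≡N) ⟩
    ∑ (suc L + suc k) F                                  ≡⟨ ∑-+ (suc L) (suc k) F ⟩
    ∑ (suc L) F + ∑ (suc k) (λ j → F (suc L + j))        ≡⟨ cong₂ _+_ (∑-zero (suc L) below-N) (∑-cong (suc k) above-N) ⟩
    ∑ (suc k) (λ j → if e ≤ᵇ j then 1 else 0)            ≡⟨ ∑-suffix-reversed (suc k) e (λ _ → 1) ⟩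
    ∑ (suc k ∸ e) (λ _ → 1)                              ≡⟨ ∑-const-1 (suc k ∸ e) ⟩
    suc k ∸ e                                            ≡⟨ suc[B]∸threshold ps (suc k) (B-split L 0 L+1≡N) ⟨
    suc B ∸ threshold ps                                 ∎
    where
    open ≡-Reasoning
    L : ℕ
    L = length ps
    e : ℕ
    e = threshold ps ∸ (2 + L)
    1+L≡N : suc L ≡ N
    1+L≡N = trans (+-comm 1 L) L+1≡N
    F : ℕ → ℕ
    F i = if admits 1 ps (suc i) ∧ (suc N ≤ᵇ suc i) then 1 else 0
    below-N : ∀ i → i < suc L → F i ≡ 0
    below-N i i<1+L = cong (λ b → if b then 1 else 0)
      (trans (cong (admits 1 ps (suc i) ∧_) (≤ᵇ-false (s≤s (subst (i <_) 1+L≡N i<1+L)))) (∧-zeroʳ _))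
    above-N : ∀ j → F (suc L + j) ≡ (if e ≤ᵇ j then 1 else 0)
    above-N j = cong (λ b → if b then 1 else 0)
      (trans (cong₂ _∧_ (admits-above ps j) (≤ᵇ-true (s≤s (subst (_≤ suc L + j) 1+L≡N (m≤m+n (suc L) j)))))
             (∧-identityʳ _))

  counts-low : ∀ R → Counts R → ∀ ps → length ps + suc (suc R) ≡ N →
    ∑ (suc (length ps)) (λ i → if admits 1 ps (suc i) then continuations R (suc i ∷ ps) else 0)
      ≡ ∑ (lowCount ps) (λ q → completions R (2 + q) (B ∸ threshold ps))
  counts-low R ih ps L+2+R≡N = trans (∑-cong< (suc L) entry) (∑-by-rank (suc L) P g)
    where
    L : ℕ
    L = length ps
    P : ℕ → Bool
    P i = admits 1 ps (suc i)
    g : ℕ → ℕ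
    g x = completions R (suc x) (B ∸ threshold ps)
    entry : ∀ i → i < suc L →
      (if P i then continuations R (suc i ∷ ps) else 0) ≡ (if P i then g (count< (suc L) (λ j → (i ≤ᵇ j) ∧ P j)) else 0)
    entry i i<1+L = cong (λ n → if P i then n else 0) (trans
      (ih (suc i ∷ ps) (trans (sym (+-suc L (suc R))) L+2+R≡N))
      (cong₂ (completions R) (lowCount-low i ps)
             (cong (B ∸_) (m≤n⇒m⊔n≡n (≤-trans i<1+L (≤-trans (n≤1+n (suc L)) (threshold-≥ ps)))))))

  counts-high : ∀ R → Counts R → ∀ ps → length ps + suc (suc R) ≡ N →
    ∑ (suc R + suc k) (λ j → if admits 1 ps (2 + length ps + j) then continuations R (2 + length ps + j ∷ ps) else 0)
      ≡ ∑ (suc B ∸ threshold ps) (completions R 1)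
  counts-high R ih ps L+2+R≡N = begin
    ∑ M (λ j → if admits 1 ps (2 + L + j) then continuations R (2 + L + j ∷ ps) else 0)
      ≡⟨ ∑-cong M (λ j → if-cong (admits-above ps j) (λ e≤ᵇj → entry j (≤ᵇ⇒≤ e j e≤ᵇj))) ⟩
    ∑ M (λ j → if e ≤ᵇ j then completions R 1 (M ∸ suc j) else 0)
      ≡⟨ ∑-suffix-reversed M e (completions R 1) ⟩
    ∑ (M ∸ e) (completions R 1)
      ≡⟨ cong (λ n → ∑ n (completions R 1)) (suc[B]∸threshold ps M B≡) ⟨
    ∑ (suc B ∸ threshold ps) (completions R 1)
      ∎
    where
    open ≡-Reasoning
    L : ℕ
    L = length ps
    M : ℕ
    M = suc R + suc k
    e : ℕ
    e = threshold ps ∸ (2 + L)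
    B≡ : B ≡ suc L + M
    B≡ = B-split L (suc R) L+2+R≡N
    entry : ∀ j → e ≤ j → continuations R (2 + L + j ∷ ps) ≡ completions R 1 (M ∸ suc j)
    entry j e≤j = begin
      continuations R (2 + L + j ∷ ps)
        ≡⟨ ih (2 + L + j ∷ ps) (trans (sym (+-suc L (suc R))) L+2+R≡N) ⟩
      completions R (lowCount (2 + L + j ∷ ps)) (B ∸ ((2 + L + j) ⊔ threshold ps))
        ≡⟨ cong₂ (completions R) (lowCount-high (2 + L + j) ps (m≤m+n (2 + L) j)) (cong (B ∸_) (m≥n⇒m⊔n≡m threshold≤)) ⟩
      completions R 1 (B ∸ (2 + L + j))
        ≡⟨ cong (completions R 1) (cong₂ _∸_ B≡ (sym (+-suc (suc L) j))) ⟩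
      completions R 1 ((suc L + M) ∸ (suc L + suc j))
        ≡⟨ cong (completions R 1) ([m+n]∸[m+o]≡n∸o (suc L) M (suc j)) ⟩
      completions R 1 (M ∸ suc j)
        ∎
      where
      threshold≤ : threshold ps ≤ 2 + L + j
      threshold≤ = subst (_≤ 2 + L + j) (m+[n∸m]≡n (threshold-≥ ps)) (+-monoʳ-≤ (2 + L) e≤j)

  counts : ∀ R → Counts R
  counts zero    = counts-zero
  counts (suc R) ps L+2+R≡N = begin
    continuations (suc R) ps
      ≡⟨ continuations-suc R ps ⟩
    ∑ B G
      ≡⟨ cong (λ n → ∑ n G) (B-split L (suc R) L+2+R≡N) ⟩
    ∑ (suc L + (suc R + suc k)) G
      ≡⟨ ∑-+ (suc L) (suc R + suc k) G ⟩
    ∑ (suc L) G + ∑ (suc R + suc k) (λ j → G (suc L + j))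
      ≡⟨ cong₂ _+_ (counts-low R (counts R) ps L+2+R≡N) (counts-high R (counts R) ps L+2+R≡N) ⟩
    ∑ (lowCount ps) (λ q → completions R (2 + q) (B ∸ threshold ps)) + ∑ (suc B ∸ threshold ps) (completions R 1)
      ≡⟨ cong (λ v → ∑ (lowCount ps) (λ q → completions R (2 + q) v) + ∑ (suc B ∸ threshold ps) (completions R 1))
              (trans (cong (suc B ∸_) (+-comm 1 (threshold ps))) (sym (∸-+-assoc (suc B) (threshold ps) 1))) ⟩
    completions (suc R) (lowCount ps) (suc B ∸ threshold ps)
      ∎
    where
    open ≡-Reasoning
    L : ℕ
    L = length ps
    G : ℕ → ℕ
    G i = if admits 1 ps (suc i) then continuations R (suc i ∷ ps) else 0

card-F≡ballot : ∀ m k → card-F (suc m) k ≡ ballot (suc m) k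
card-F≡ballot m k = begin
  length (filter (cond? (suc m)) (seqs (suc m) (suc m + k + 1)))
    ≡⟨ cong (λ b → length (filter (cond? (suc m)) (seqs (suc m) b))) (trans (+-assoc (suc m) k 1) (cong (suc m +_) (+-comm k 1))) ⟩
  length (filter (cond? (suc m)) (seqs (suc m) B))
    ≡⟨ length-filter≡count (cond? (suc m)) (seqs (suc m) B) ⟩
  count (λ u → does (cond? (suc m) u)) (seqs (suc m) B)
    ≡⟨ count-cong (seqs (suc m) B) cond≡accepts ⟩
  continuations m []
    ≡⟨ counts m [] refl ⟩
  completions m 1 (m + suc k)
    ≡⟨ completions-closedForm m 1 (m + suc k) ⟩
  ∑ (m + suc k ∸ m) (λ t → ballot m (suc t))
    ≡⟨ cong (λ n → ∑ n (λ t → ballot m (suc t))) (m+n∸m≡n m (suc k)) ⟩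
  ballot (suc m) k
    ∎
  where
  open ≡-Reasoning
  open Counting (suc m) k

proposition5 : (n k : ℕ) → 1 ≤ n →
    (n + n + k + 1) * card-F n k ≡ (k + 1) * ((n + n + k + 1) C n)
proposition5 (suc m) k _ = trans (cong ((suc m + suc m + k + 1) *_) (card-F≡ballot m k)) (ballot-closedForm m k)
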